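{- Let $S=S[1..n]$ be a string, let $0\le k\le n-1$, and let $2\le p\le n$. If $\mathrm{LSUS}_p^k$ exists, then $|\mathrm{LSUS}_p^k|\ge |\mathrm{LSUS}_{p-1}^k|-1$.
   Context: For $1\le i\le j\le n$, $S[i..j]=S[i]\cdots S[j]$ is a substring of length $j-i+1$. $H$ denotes the Hamming distance between equal-length strings. For an integer $k\ge 0$, a substring $S[i..j]$ is $k$-mismatch unique if there is no substring $S[i'..j']$ with $i'\ne i$, $j'-i'=j-i$ and $H(S[i..j],S[i'..j'])\le k$. For a position $p$, $\mathrm{LSUS}_p^k$ (the $k$-mismatch left-bounded shortest unique substring starting at $p$) is the shortest $k$-mismatch unique substring of the form $S[p..j]$, if one exists; otherwise $\mathrm{LSUS}_p^k$ does not exist. -}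

module Defs where

open import Level using (Level)
open import Data.Nat using (ℕ; zero; suc; _+_; _∸_; _≤_; _<_)
open import Data.List using (List; []; _∷_; take; drop; length)
open import Data.Product using (_×_)
open import Relation.Nullary using (¬_; does)
open import Relation.Binary.Definitions using (DecidableEquality)
open import Relation.Binary.PropositionalEquality using (_≡_; _≢_)
open import Data.Bool using (if_then_else_)

private variable
  a : Level
  A : Set a

-- Hamming distance (number of mismatching positions) of two lists;
-- only ever applied to lists of equal length.
hamming : DecidableEquality A → List A → List A → ℕ
hamming _≟_ [] _ = 0
hamming _≟_ (_ ∷ _) [] = 0
hamming _≟_ (x ∷ xs) (y ∷ ys) =
  (if does (x ≟ y) then 0 else 1) + hamming _≟_ xs ys

-- 1-based substring S[i..j] = S[i] ⋯ S[j]  (meaningful when 1 ≤ i ≤ j ≤ |S|)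
substr : List A → ℕ → ℕ → List A
substr S i j = take (suc j ∸ i) (drop (i ∸ 1) S)

ValidSub : ℕ → ℕ → ℕ → Set
ValidSub n i j = (1 ≤ i) × (i ≤ j) × (j ≤ n)

KUnique : DecidableEquality A → List A → ℕ → ℕ → ℕ → Set
KUnique _≟_ S k i j =
  ValidSub (length S) i j ×
  (∀ i' j' → ValidSub (length S) i' j' → i' ≢ i → j' ∸ i' ≡ j ∸ i →
     k < hamming _≟_ (substr S i j) (substr S i' j'))

IsLSUS : DecidableEquality A → List A → ℕ → ℕ → ℕ → Set
IsLSUS _≟_ S k p j =
  KUnique _≟_ S k p j × (∀ j' → p ≤ j' → j' < j → ¬ KUnique _≟_ S k p j')

-- Extending a k-mismatch unique substring one position to the left keeps it
-- k-mismatch unique: every competing occurrence of S[p-1..j] contains, after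
-- its first character, a competing occurrence of S[p..j], and dropping a
-- character never increases the Hamming distance. Hence if LSUS_p^k = S[p..j]
-- then S[p-1..j] is k-mismatch unique, so LSUS_{p-1}^k exists (uniqueness is
-- decidable, so a shortest one can be found) and ends at or before j.
module Submission where

open import Defs
open import Level using (Level)
open import Data.Nat using (ℕ; suc; _∸_; _≤_; _<_; z≤n; s≤s; pred; _≤?_; _<?_)
open import Data.Nat.Properties renaming (_≟_ to _≟ℕ_)
open import Data.Nat.Induction using (<-rec)
open import Data.List using (List; []; _∷_; length; take; drop)
open import Data.List.Properties using (take-drop; drop-drop)
open import Data.Product using (_×_; ∃-syntax; _,_)
open import Function using (_∘_)
open import Relation.Binary.Definitions using (DecidableEquality)
open import Relation.Binary.PropositionalEquality
open import Relation.Nullary using (Dec; yes; no; ¬_)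
open import Relation.Nullary.Decidable using (_×-dec_; _→-dec_; ¬?; map′)
open import Relation.Unary using (Pred; Decidable)

private variable
  a : Level
  A : Set a

module _ (_≟_ : DecidableEquality A) where

  hamming-[]ʳ : (xs : List A) → hamming _≟_ xs [] ≡ 0
  hamming-[]ʳ []      = refl
  hamming-[]ʳ (_ ∷ _) = refl

  hamming-drop₁-≤ : (xs ys : List A) → hamming _≟_ (drop 1 xs) (drop 1 ys) ≤ hamming _≟_ xs ys
  hamming-drop₁-≤ []       _        = z≤n
  hamming-drop₁-≤ (_ ∷ xs) []       = ≤-reflexive (hamming-[]ʳ xs)
  hamming-drop₁-≤ (_ ∷ _)  (_ ∷ _)  = m≤n+m _ _

substr-suc : (S : List A) {i j : ℕ} → 1 ≤ i → i ≤ j → substr S (suc i) j ≡ drop 1 (substr S i j)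
substr-suc S {suc i} {j} _ i<j = begin
  take (j ∸ suc i) (drop (suc i) S)                  ≡⟨ cong (take (j ∸ suc i)) drop-suc ⟩
  take (j ∸ suc i) (drop 1 (drop i S))               ≡⟨ take-drop (j ∸ suc i) 1 (drop i S) ⟩
  drop 1 (take (suc (j ∸ suc i)) (drop i S))         ≡⟨ cong (λ m → drop 1 (take m (drop i S))) (+-∸-assoc 1 i<j) ⟨
  drop 1 (take (suc j ∸ suc i) (drop i S))           ∎
  where
  open ≡-Reasoning
  drop-suc : drop (suc i) S ≡ drop 1 (drop i S)
  drop-suc = trans (cong (λ m → drop m S) (+-comm 1 i)) (sym (drop-drop i 1 S))

module _ (_≟_ : DecidableEquality A) (S : List A) (k : ℕ) where

  KUnique-extendˡ : ∀ {q j} → 1 ≤ q → KUnique _≟_ S k (suc q) j → KUnique _≟_ S k q j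
  KUnique-extendˡ {q} {j} 1≤q ((_ , q<j , j≤n) , unique) = (1≤q , q≤j , j≤n) , unique′
    where
    q≤j : q ≤ j
    q≤j = <⇒≤ q<j

    unique′ : ∀ i' j' → ValidSub (length S) i' j' → i' ≢ q → j' ∸ i' ≡ j ∸ q →
              k < hamming _≟_ (substr S q j) (substr S i' j')
    unique′ i' j' (1≤i' , i'≤j' , j'≤n) i'≢q len≡ = begin-strict
      k                                                      <⟨ unique (suc i') j' valid (i'≢q ∘ suc-injective) len≡′ ⟩
      hamming _≟_ (substr S (suc q) j) (substr S (suc i') j') ≡⟨ cong₂ (hamming _≟_) (substr-suc S 1≤q q≤j) (substr-suc S 1≤i' i'≤j') ⟩
      hamming _≟_ (drop 1 (substr S q j)) (drop 1 (substr S i' j')) ≤⟨ hamming-drop₁-≤ _≟_ (substr S q j) (substr S i' j') ⟩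
      hamming _≟_ (substr S q j) (substr S i' j')             ∎
      where
      open ≤-Reasoning
      i'<j' : i' < j'
      i'<j' = m∸n≢0⇒n<m (subst (_≢ 0) (sym len≡) (m>n⇒m∸n≢0 q<j))
      valid : ValidSub (length S) (suc i') j'
      valid = s≤s z≤n , i'<j' , j'≤n
      len≡′ : j' ∸ suc i' ≡ j ∸ suc q
      len≡′ = trans (sym (pred[m∸n]≡m∸[1+n] j' i')) (trans (cong pred len≡) (pred[m∸n]≡m∸[1+n] j q))

  KUnique? : ∀ i j → Dec (KUnique _≟_ S k i j)
  KUnique? i j = validSub? i j ×-dec map′ fromBounded toBounded (allUpTo? (λ i' → allUpTo? (Occ? i') (suc n)) (suc n))
    where
    n : ℕ
    n = length S

    validSub? : ∀ i j → Dec (ValidSub n i j)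
    validSub? i j = (1 ≤? i) ×-dec (i ≤? j) ×-dec (j ≤? n)

    Occ : ℕ → ℕ → Set
    Occ i' j' = ValidSub n i' j' → i' ≢ i → j' ∸ i' ≡ j ∸ i →
                k < hamming _≟_ (substr S i j) (substr S i' j')

    Occ? : ∀ i' j' → Dec (Occ i' j')
    Occ? i' j' = validSub? i' j' →-dec ¬? (i' ≟ℕ i) →-dec (j' ∸ i' ≟ℕ j ∸ i) →-dec (k <? _)

    fromBounded : (∀ {i'} → i' < suc n → ∀ {j'} → j' < suc n → Occ i' j') → ∀ i' j' → Occ i' j'
    fromBounded occ i' j' v@(_ , i'≤j' , j'≤n) = occ (s≤s (≤-trans i'≤j' j'≤n)) (s≤s j'≤n) v

    toBounded : (∀ i' j' → Occ i' j') → ∀ {i'} → i' < suc n → ∀ {j'} → j' < suc n → Occ i' j'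
    toBounded occ {i'} _ {j'} _ = occ i' j'

least-witness : ∀ {ℓ} {P : Pred ℕ ℓ} → Decidable P → ∀ {n} → P n →
                ∃[ m ] (m ≤ n × P m × (∀ m' → m' < m → ¬ P m'))
least-witness {P = P} P? {n} = <-rec Goal search n
  where
  Goal : ℕ → Set _
  Goal n = P n → ∃[ m ] (m ≤ n × P m × (∀ m' → m' < m → ¬ P m'))

  search : ∀ n → (∀ {m} → m < n → Goal m) → Goal n
  search n rec Pn with anyUpTo? P? n
  ... | no none = n , ≤-refl , Pn , λ m' m'<n Pm' → none (m' , m'<n , Pm')
  ... | yes (m , m<n , Pm) with rec m<n Pm
  ...   | l , l≤m , Pl , minimal = l , ≤-trans l≤m (<⇒≤ m<n) , Pl , minimal

IsLSUS-bounded : (_≟_ : DecidableEquality A) (S : List A) (k p j : ℕ) →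
                 KUnique _≟_ S k p j → ∃[ j' ] (IsLSUS _≟_ S k p j' × j' ≤ j)
IsLSUS-bounded _≟_ S k p j unique with least-witness (KUnique? _≟_ S k p) unique
... | j' , j'≤j , unique′ , shortest = j' , (unique′ , λ m _ → shortest m) , j'≤j

lemma2 : ∀ {a : Level} {A : Set a} (_≟_ : DecidableEquality A) (S : List A) (k p : ℕ) →
    k ≤ length S ∸ 1 → 2 ≤ p → p ≤ length S →
    ∀ j → IsLSUS _≟_ S k p j →
    ∃[ j' ] (IsLSUS _≟_ S k (p ∸ 1) j' × suc j' ∸ (p ∸ 1) ≤ suc (suc j ∸ p))
lemma2 _≟_ S k (suc q) _ (s≤s 1≤q) _ j (unique@((_ , q<j , _) , _) , _)
  with IsLSUS-bounded _≟_ S k q j (KUnique-extendˡ _≟_ S k 1≤q unique)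
... | j' , lsus , j'≤j = j' , lsus , (begin
  suc j' ∸ q      ≤⟨ ∸-monoˡ-≤ q (s≤s j'≤j) ⟩
  suc j ∸ q       ≡⟨ +-∸-assoc 1 q≤j ⟩
  suc (j ∸ q)     ∎)
  where
  open ≤-Reasoning
  q≤j : q ≤ j
  q≤j = <⇒≤ q<j
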